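{- There exist a constant $c>0$ and an infinite sequence of strings $w_1,w_2,\dots$ with $|w_k|\to\infty$ such that for every $k$ with $|w_k|\ge 2$: $r(w_k)=2$ and $r_B(w_k)\ge c\log|w_k|$. Here $r(w)$ denotes the number of maximal runs of equal characters in $\mathsf{BWT}(w)$, and $r_B(w)$ the number of maximal runs of equal characters in $\mathsf{BBWT}(w)$.
   Context: Strings are over a totally ordered alphabet, with lexicographic order $\prec$. $\mathsf{BWT}(w)$ is the string obtained by sorting the $|w|$ cyclic rotations of $w$ (with multiplicity) lexicographically and concatenating their last characters. A Lyndon word is a nonempty string strictly lexicographically smaller than all its proper nonempty suffixes. Every string $w$ has a unique Lyndon factorization $w=u_1\cdots u_m$ into Lyndon words with $u_1\succeq\cdots\succeq u_m$. For primitive $x,y$, $x\prec_\omega y$ iff $x^\infty\prec y^\infty$, where $x^\infty = xxx\cdots$. $\mathsf{BBWT}(w)$ is obtained as follows: take the multiset of all cyclic rotations of all factors $u_j$ (each contributing its $|u_j|$ rotations, repeated factors contributing repeatedly), sort it in $\omega$-order, and concatenate the last characters. -}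

module Defs where

open import Data.Nat using (ℕ; zero; suc; _+_; _<_; _%_)
open import Data.Bool using (if_then_else_)
open import Data.Nat using (_≡ᵇ_)
open import Data.List using (List; []; _∷_; _++_; length; drop; take; map; upTo; concat; concatMap)
open import Data.List.Relation.Unary.All using (All)
open import Data.List.Relation.Unary.Linked using (Linked)
open import Data.List.Relation.Binary.Permutation.Propositional using (_↭_)
open import Data.Product using (Σ; _×_; ∃)
open import Data.Sum using (_⊎_)
open import Relation.Binary.PropositionalEquality using (_≡_; _≢_)

Str : Set
Str = List ℕ

-- Non-strict lexicographic order (a proper prefix is smaller).
data _≼_ : Str → Str → Set where
  []≼ : ∀ {ys} → [] ≼ ys
  <≼  : ∀ {x y xs ys} → x < y → (x ∷ xs) ≼ (y ∷ ys)
  ≡≼  : ∀ {x xs ys} → xs ≼ ys → (x ∷ xs) ≼ (x ∷ ys)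

_≺_ : Str → Str → Set
u ≺ v = (u ≼ v) × (u ≢ v)

IsLyndon : Str → Set
IsLyndon w = (w ≢ []) × (∀ (p s : Str) → p ≢ [] → s ≢ [] → w ≡ p ++ s → w ≺ s)

IsLyndonFactorization : Str → List Str → Set
IsLyndonFactorization w us =
  (concat us ≡ w) × All IsLyndon us × Linked (λ a b → b ≼ a) us

rotations : Str → List Str
rotations w = map (λ i → drop i w ++ take i w) (upTo (length w))

-- Last character (default 0 on the empty string; never used there).
lastChar : Str → ℕ
lastChar []           = 0
lastChar (x ∷ [])     = x
lastChar (_ ∷ y ∷ ys) = lastChar (y ∷ ys)

-- i-th character (default 0 out of range).
at : Str → ℕ → ℕ
at []       _       = 0
at (x ∷ _)  zero    = x
at (_ ∷ xs) (suc i) = at xs i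

-- The infinite word x^∞ = xxx⋯ as a function ℕ → ℕ.
omega : Str → ℕ → ℕ
omega []          _ = 0
omega x@(_ ∷ _)   i = at x (i % length x)

_<ω_ : Str → Str → Set
x <ω y = ∃ λ i → (∀ j → j < i → omega x j ≡ omega y j) × (omega x i < omega y i)

_≤ω_ : Str → Str → Set
x ≤ω y = (x <ω y) ⊎ (∀ i → omega x i ≡ omega y i)

runs : Str → ℕ
runs []           = 0
runs (x ∷ [])     = 1
runs (x ∷ y ∷ t)  = (if x ≡ᵇ y then 0 else 1) + runs (y ∷ t)

IsBWT : Str → Str → Set
IsBWT w s = Σ (List Str) λ L →
  (L ↭ rotations w) × Linked _≼_ L × (s ≡ map lastChar L)

IsBBWT : Str → Str → Set
IsBBWT w s = Σ (List Str) λ us → IsLyndonFactorization w us ×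
  Σ (List Str) λ L →
    (L ↭ concatMap rotations us) × Linked _≤ω_ L × (s ≡ map lastChar L)

-- Let ψ be the morphism 0 ↦ 001, 1 ↦ 01 and Φ R the rotation of ψ R moving its final 01 to the front.
-- Take W 0 = 0 and W (j+1) = Φ (W j), so |W j| ≤ 3^j.  On binary words ψ, hence Φ, is monotone for the
-- ω-order: a first difference 0 < 1 of x^∞ and y^∞ becomes a first difference 001 < 01.  By induction,
-- every rotation of W j ending in 1 is ω-below every rotation ending in 0; as the lexicographic order of
-- equally long words cannot reverse their ω-order, BWT (W (j+1)) is 1⋯10⋯0.
-- ψ preserves Lyndon words, so W j = 01 · ψ(01) ⋯ ψ^(j-1)(01) · 0 is its Lyndon factorisation.  Applying Φ
-- to an ω-increasing chain of rotations of these factors keeps it increasing and keeps the last letters;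
-- appending 01, 10 thus yields 2j rotations with alternating last letters, which together with 0 occur in
-- this order among the ω-sorted rotations.  So BBWT (W j) has at least 2j+1 ≥ log₂ |W j| runs.

module Submission where

open import Defs
open import Data.Nat using (ℕ; zero; suc; _+_; _*_; _^_; _<_; _≤_; _≥_; z≤n; s≤s; z<s; s<s; _%_; _≡ᵇ_; >-nonZero)
open import Data.Nat.Properties
open import Data.Nat.DivMod using (m<n⇒m%n≡m; [m+n]%n≡m%n; n%1≡0)
open import Data.List using (List; []; _∷_; [_]; _++_; length; drop; take; map; concat; concatMap)
open import Data.List.Properties using (++-assoc; ++-identityʳ; ++-conicalʳ; concat-++; map-∘; map-cong-local; length-++; length-++-comm; ∷-injective; take++drop≡id; map-++; concatMap-++)
open import Data.Product using (Σ; _×_; ∃; _,_; proj₁; proj₂; uncurry; map₂)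
open import Data.Sum using (_⊎_; inj₁; inj₂)
open import Data.Bool using (true; false; if_then_else_; T)
open import Data.Empty using (⊥-elim)
open import Relation.Nullary using (¬_; yes; no)
open import Data.List.Relation.Unary.All as All using (All; []; _∷_)
import Data.List.Relation.Unary.All.Properties as Allₚ
open import Data.List.Membership.Propositional using (_∈_)
open import Data.List.Relation.Unary.Any using (here; there)
open import Data.List.Relation.Unary.Linked using (Linked; []; [-]; _∷_)
import Data.List.Relation.Unary.Linked.Properties as Linkedₚ
open import Data.List.Relation.Unary.AllPairs using (AllPairs; []; _∷_)
open import Data.List.Relation.Binary.Sublist.Propositional using (_⊆_; []; _∷_; _∷ʳ_)
open import Data.List.Relation.Binary.Sublist.Propositional.Properties using () renaming (map⁺ to ⊆-map⁺)
open import Data.List.Membership.Propositional.Properties using (∈-map⁺; ∈-map⁻; ∈-upTo⁺; ∈-∃++; ∈-concat⁺′; ∈-++⁺ˡ; ∈-++⁺ʳ)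
open import Data.List.Relation.Binary.Permutation.Propositional using (_↭_; ↭-sym; ↭-refl; ↭-trans; ↭-prep; ↭-swap)
open import Data.List.Relation.Binary.Permutation.Propositional.Properties using (All-resp-↭; ∈-resp-↭; ↭-length; ↭-singleton-inv) renaming (++-comm to ↭-++-comm)
open import Relation.Binary.PropositionalEquality hiding ([_])
open import Relation.Binary.Definitions using (tri<; tri≈; tri>)

++-equidivisible : ∀ {A : Set} (a b c d : List A) → a ++ b ≡ c ++ d →
  (∃ λ m → c ≡ a ++ m × b ≡ m ++ d) ⊎ (∃ λ m → a ≡ c ++ m × d ≡ m ++ b)
++-equidivisible [] b c d eq = inj₁ (c , refl , eq)
++-equidivisible (x ∷ a) b [] d eq = inj₂ (x ∷ a , refl , sym eq)
++-equidivisible (x ∷ a) b (y ∷ c) d eq with ∷-injective eq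
... | refl , eq′ with ++-equidivisible a b c d eq′
...   | inj₁ (m , c≡am , b≡md) = inj₁ (m , cong (x ∷_) c≡am , b≡md)
...   | inj₂ (m , a≡cm , d≡mb) = inj₂ (m , cong (x ∷_) a≡cm , d≡mb)

drop-length-++ : ∀ {A : Set} (x y : List A) → drop (length x) (x ++ y) ≡ y
drop-length-++ [] y = refl
drop-length-++ (c ∷ x) y = drop-length-++ x y

take-length-++ : ∀ {A : Set} (x y : List A) → take (length x) (x ++ y) ≡ x
take-length-++ [] y = refl
take-length-++ (c ∷ x) y = cong (c ∷_) (take-length-++ x y)

snoc-nonempty : ∀ {A : Set} (s : List A) c → 0 < length (s ++ [ c ])
snoc-nonempty [] c = z<s
snoc-nonempty (_ ∷ _) c = z<s

∈⇒nonempty : ∀ {A : Set} {c : A} {w} → c ∈ w → 0 < length w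
∈⇒nonempty (here _) = z<s
∈⇒nonempty (there _) = z<s

≢[]⇒nonempty : ∀ {A : Set} {x : List A} → x ≢ [] → 0 < length x
≢[]⇒nonempty {x = []} x≢[] = ⊥-elim (x≢[] refl)
≢[]⇒nonempty {x = _ ∷ _} _ = z<s

lastChar-++ : ∀ xs ys → 0 < length ys → lastChar (xs ++ ys) ≡ lastChar ys
lastChar-++ [] ys _ = refl
lastChar-++ (x ∷ []) (y ∷ ys) _ = refl
lastChar-++ (x ∷ x′ ∷ xs) ys ys≢[] = lastChar-++ (x′ ∷ xs) ys ys≢[]

lastChar-snoc : ∀ xs c → lastChar (xs ++ [ c ]) ≡ c
lastChar-snoc xs c = lastChar-++ xs [ c ] z<s

Linked-∷⁺ : ∀ {A : Set} {R : A → A → Set} {x ys} → All (R x) ys → Linked R ys → Linked R (x ∷ ys)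
Linked-∷⁺ [] [] = [-]
Linked-∷⁺ (Rxy ∷ _) sorted = Rxy ∷ sorted

Linked-++-∷ : ∀ {A : Set} {R : A → A → Set} {xs y ys} →
  Linked R xs → All (λ x → R x y) xs → Linked R (y ∷ ys) → Linked R (xs ++ y ∷ ys)
Linked-++-∷ [] [] sorted = sorted
Linked-++-∷ [-] (Rxy ∷ []) sorted = Rxy ∷ sorted
Linked-++-∷ (Rxx′ ∷ sorted₁) (_ ∷ below) sorted₂ = Rxx′ ∷ Linked-++-∷ sorted₁ below sorted₂

-- Data.List.Sort needs a decidable total order; _≤ω_ is only a total preorder.
module InsertionSort {A : Set} (_≤_ : A → A → Set) (total : ∀ x y → x ≤ y ⊎ y ≤ x) where

  insert : A → List A → List A
  insert x [] = [ x ]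
  insert x (y ∷ ys) with total x y
  ... | inj₁ _ = x ∷ y ∷ ys
  ... | inj₂ _ = y ∷ insert x ys

  sort : List A → List A
  sort [] = []
  sort (x ∷ xs) = insert x (sort xs)

  insert-↭ : ∀ x ys → insert x ys ↭ x ∷ ys
  insert-↭ x [] = ↭-refl
  insert-↭ x (y ∷ ys) with total x y
  ... | inj₁ _ = ↭-refl
  ... | inj₂ _ = ↭-trans (↭-prep y (insert-↭ x ys)) (↭-swap y x ↭-refl)

  sort-↭ : ∀ xs → sort xs ↭ xs
  sort-↭ [] = ↭-refl
  sort-↭ (x ∷ xs) = ↭-trans (insert-↭ x (sort xs)) (↭-prep x (sort-↭ xs))

  insert-sorted : ∀ x {ys} → Linked _≤_ ys → Linked _≤_ (insert x ys)
  insert-sorted x [] = [-]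
  insert-sorted x {y ∷ ys} sorted with total x y
  ... | inj₁ x≤y = x≤y ∷ sorted
  ... | inj₂ y≤x = insert-below y≤x sorted
    where
    insert-below : ∀ {y ys} → y ≤ x → Linked _≤_ (y ∷ ys) → Linked _≤_ (y ∷ insert x ys)
    insert-below y≤x [-] = y≤x ∷ [-]
    insert-below {ys = z ∷ zs} y≤x (y≤z ∷ sorted) with total x z
    ... | inj₁ x≤z = y≤x ∷ x≤z ∷ sorted
    ... | inj₂ z≤x = y≤z ∷ insert-below z≤x sorted

  sort-sorted : ∀ xs → Linked _≤_ (sort xs)
  sort-sorted [] = []
  sort-sorted (x ∷ xs) = insert-sorted x (sort-sorted xs)

module _ {A : Set} {_≤_ _<_ : A → A → Set}
         (<-irrefl : ∀ {x} → ¬ x < x) (≤-<-trans : ∀ {x y z} → x ≤ y → y < z → x < z) where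

  ∈-tail : ∀ {y e ys} → y < e → e ∈ y ∷ ys → e ∈ ys
  ∈-tail y<e (here refl) = ⊥-elim (<-irrefl y<e)
  ∈-tail _ (there e∈ys) = e∈ys

  increasing-⊆-nondecreasing : ∀ {xs ys} → AllPairs _<_ xs → AllPairs _≤_ ys → All (_∈ ys) xs → xs ⊆ ys
  increasing-⊆-nondecreasing {[]} {[]} _ _ _ = []
  increasing-⊆-nondecreasing {[]} {y ∷ ys} _ (_ ∷ ≤ys) _ = y ∷ʳ increasing-⊆-nondecreasing [] ≤ys []
  increasing-⊆-nondecreasing {x ∷ xs} {y ∷ ys} (x<xs ∷ <xs) (_ ∷ ≤ys) (here refl ∷ xs∈) =
    refl ∷ increasing-⊆-nondecreasing <xs ≤ys (All.zipWith (uncurry ∈-tail) (x<xs , xs∈))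
  increasing-⊆-nondecreasing {x ∷ xs} {y ∷ ys} (x<xs ∷ <xs) (y≤ys ∷ ≤ys) (there x∈ys ∷ xs∈) =
    y ∷ʳ increasing-⊆-nondecreasing (x<xs ∷ <xs) ≤ys (x∈ys ∷ All.zipWith drop-y (x<xs , xs∈))
    where
    drop-y : ∀ {e} → x < e × e ∈ y ∷ ys → e ∈ ys
    drop-y (x<e , e∈) = ∈-tail (≤-<-trans (All.lookup y≤ys x∈ys) x<e) e∈

-- Infinite words and the ω-order

Stream : Set
Stream = ℕ → ℕ

infixr 5 _++ˢ_
_++ˢ_ : Str → Stream → Stream
([] ++ˢ F) i = F i
((c ∷ p) ++ˢ F) zero = c
((c ∷ p) ++ˢ F) (suc i) = (p ++ˢ F) i

-- Chosen so that x <ω y and x ≤ω y unfold to omega x <ˢ omega y and omega x ≤ˢ omega y.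
infix 4 _<ˢ_ _≤ˢ_
_<ˢ_ : Stream → Stream → Set
F <ˢ G = ∃ λ i → (∀ j → j < i → F j ≡ G j) × F i < G i

_≤ˢ_ : Stream → Stream → Set
F ≤ˢ G = F <ˢ G ⊎ F ≗ G

<ˢ-resp-≗ : ∀ {F F′ G G′} → F ≗ F′ → G ≗ G′ → F <ˢ G → F′ <ˢ G′
<ˢ-resp-≗ F≗F′ G≗G′ (i , agree , lt) =
  i , (λ j j<i → trans (sym (F≗F′ j)) (trans (agree j j<i) (G≗G′ j))) ,
  subst₂ _<_ (F≗F′ i) (G≗G′ i) lt

≤ˢ-resp-≗ : ∀ {F F′ G G′} → F ≗ F′ → G ≗ G′ → F ≤ˢ G → F′ ≤ˢ G′
≤ˢ-resp-≗ F≗F′ G≗G′ (inj₁ lt) = inj₁ (<ˢ-resp-≗ F≗F′ G≗G′ lt)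
≤ˢ-resp-≗ F≗F′ G≗G′ (inj₂ F≗G) = inj₂ (λ i → trans (sym (F≗F′ i)) (trans (F≗G i) (G≗G′ i)))

<ˢ-irrefl : ∀ {F} → ¬ F <ˢ F
<ˢ-irrefl (_ , _ , lt) = <-irrefl refl lt

<ˢ-trans : ∀ {F G H} → F <ˢ G → G <ˢ H → F <ˢ H
<ˢ-trans {F} {G} {H} (i , agree₁ , lt₁) (j , agree₂ , lt₂) with <-cmp i j
... | tri< i<j _ _ = i , (λ k k<i → trans (agree₁ k k<i) (agree₂ k (<-trans k<i i<j))) ,
                     subst (F i <_) (agree₂ i i<j) lt₁
... | tri≈ _ refl _ = i , (λ k k<i → trans (agree₁ k k<i) (agree₂ k k<i)) , <-trans lt₁ lt₂
... | tri> _ _ j<i = j , (λ k k<j → trans (agree₁ k (<-trans k<j j<i)) (agree₂ k k<j)) ,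
                     subst (_< H j) (sym (agree₁ j j<i)) lt₂

≤ˢ-<ˢ-trans : ∀ {F G H} → F ≤ˢ G → G <ˢ H → F <ˢ H
≤ˢ-<ˢ-trans (inj₁ F<G) G<H = <ˢ-trans F<G G<H
≤ˢ-<ˢ-trans (inj₂ F≗G) G<H = <ˢ-resp-≗ (λ i → sym (F≗G i)) (λ _ → refl) G<H

≤ˢ-trans : ∀ {F G H} → F ≤ˢ G → G ≤ˢ H → F ≤ˢ H
≤ˢ-trans F≤G (inj₁ G<H) = inj₁ (≤ˢ-<ˢ-trans F≤G G<H)
≤ˢ-trans (inj₁ F<G) (inj₂ G≗H) = inj₁ (<ˢ-resp-≗ (λ _ → refl) G≗H F<G)
≤ˢ-trans (inj₂ F≗G) (inj₂ G≗H) = inj₂ (λ i → trans (F≗G i) (G≗H i))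

++ˢ-lookup : ∀ p F {i} → i < length p → (p ++ˢ F) i ≡ at p i
++ˢ-lookup (c ∷ p) F {zero} _ = refl
++ˢ-lookup (c ∷ p) F {suc i} (s<s i<p) = ++ˢ-lookup p F i<p

++ˢ-beyond : ∀ p F i → (p ++ˢ F) (length p + i) ≡ F i
++ˢ-beyond [] F i = refl
++ˢ-beyond (c ∷ p) F i = ++ˢ-beyond p F i

++ˢ-cong : ∀ p {F G} → F ≗ G → p ++ˢ F ≗ p ++ˢ G
++ˢ-cong [] F≗G i = F≗G i
++ˢ-cong (c ∷ p) F≗G zero = refl
++ˢ-cong (c ∷ p) F≗G (suc i) = ++ˢ-cong p F≗G i

++ˢ-assoc : ∀ p q F → (p ++ q) ++ˢ F ≗ p ++ˢ q ++ˢ F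
++ˢ-assoc [] q F i = refl
++ˢ-assoc (c ∷ p) q F zero = refl
++ˢ-assoc (c ∷ p) q F (suc i) = ++ˢ-assoc p q F i

++ˢ-monoʳ-<ˢ : ∀ p {F G} → F <ˢ G → p ++ˢ F <ˢ p ++ˢ G
++ˢ-monoʳ-<ˢ [] F<G = F<G
++ˢ-monoʳ-<ˢ (c ∷ p) {F} {G} F<G with ++ˢ-monoʳ-<ˢ p F<G
... | i , agree , lt = suc i , agree′ , lt
  where
  agree′ : ∀ j → j < suc i → ((c ∷ p) ++ˢ F) j ≡ ((c ∷ p) ++ˢ G) j
  agree′ zero _ = refl
  agree′ (suc j) (s<s j<i) = agree j j<i

data Diverge : Str → Str → Set where
  diverge : ∀ p {c d} r r′ → c < d → Diverge (p ++ c ∷ r) (p ++ d ∷ r′)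

Diverge-++ˡ : ∀ q {x y} → Diverge x y → Diverge (q ++ x) (q ++ y)
Diverge-++ˡ q (diverge p r r′ c<d) =
  subst₂ Diverge (++-assoc q p _) (++-assoc q p _) (diverge (q ++ p) r r′ c<d)

Diverge⇒≺ : ∀ {x y} → Diverge x y → x ≺ y
Diverge⇒≺ (diverge [] r r′ c<d) = <≼ c<d , λ eq → <-irrefl (proj₁ (∷-injective eq)) c<d
Diverge⇒≺ (diverge (a ∷ p) r r′ c<d) with Diverge⇒≺ (diverge p r r′ c<d)
... | x≼y , x≢y = ≡≼ x≼y , λ eq → x≢y (proj₂ (∷-injective eq))

Diverge⇒<ˢ : ∀ {x y} → Diverge x y → ∀ F G → x ++ˢ F <ˢ y ++ˢ G
Diverge⇒<ˢ (diverge p r r′ c<d) F G =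
  <ˢ-resp-≗ (λ i → sym (++ˢ-assoc p _ F i)) (λ i → sym (++ˢ-assoc p _ G i))
    (++ˢ-monoʳ-<ˢ p (0 , (λ _ ()) , c<d))

≼⇒≡⊎Diverge : ∀ {x y} → x ≼ y → length y ≤ length x → x ≡ y ⊎ Diverge x y
≼⇒≡⊎Diverge {[]} {[]} []≼ _ = inj₁ refl
≼⇒≡⊎Diverge (<≼ {xs = r} {ys = r′} c<d) _ = inj₂ (diverge [] r r′ c<d)
≼⇒≡⊎Diverge (≡≼ {c} x≼y) (s≤s y≤x) with ≼⇒≡⊎Diverge x≼y y≤x
... | inj₁ refl = inj₁ refl
... | inj₂ x⋈y = inj₂ (Diverge-++ˡ [ c ] x⋈y)

<ˢ⇒Diverge : ∀ X Y {F G} (X<Y : X ++ˢ F <ˢ Y ++ˢ G) →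
  proj₁ X<Y < length X → proj₁ X<Y < length Y → Diverge X Y
<ˢ⇒Diverge (c ∷ X) (d ∷ Y) (zero , _ , c<d) _ _ = diverge [] X Y c<d
<ˢ⇒Diverge (c ∷ X) (d ∷ Y) (suc i , agree , lt) (s<s i<X) (s<s i<Y) with agree 0 z<s
... | refl = Diverge-++ˡ [ c ] (<ˢ⇒Diverge X Y (i , (λ j j<i → agree (suc j) (s<s j<i)) , lt) i<X i<Y)

++ˢ-fixpoint-unique : ∀ z {F G} → 0 < length z → F ≗ z ++ˢ F → G ≗ z ++ˢ G → F ≗ G
++ˢ-fixpoint-unique z {F} {G} z≢[] F≗zF G≗zG i = agree-below (suc i) i ≤-refl
  where
  agree-below : ∀ m j → j < m → F j ≡ G j
  agree-below (suc m) j j<m =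
    trans (F≗zF j) (trans (shift z j (≤-trans j<m (+-monoˡ-≤ m z≢[]))) (sym (G≗zG j)))
    where
    shift : ∀ p j → j < length p + m → (p ++ˢ F) j ≡ (p ++ˢ G) j
    shift [] j j<m = agree-below m j j<m
    shift (c ∷ p) zero _ = refl
    shift (c ∷ p) (suc j) (s<s j<m) = shift p j j<m

omega-unfold : ∀ x → 0 < length x → omega x ≗ x ++ˢ omega x
omega-unfold x@(_ ∷ _) _ i with i <? length x
... | yes i<n = trans (cong (at x) (m<n⇒m%n≡m i<n)) (sym (++ˢ-lookup x (omega x) i<n))
... | no i≮n with m≤n⇒∃[o]m+o≡n (≮⇒≥ i≮n)
...   | k , refl = trans (cong (at x) (trans (cong (_% length x) (+-comm (length x) k)) ([m+n]%n≡m%n k (length x))))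
                        (sym (++ˢ-beyond x (omega x) k))

omega-rotate : ∀ a b → 0 < length (a ++ b) → omega (a ++ b) ≗ a ++ˢ omega (b ++ a)
omega-rotate a b ab≢[] = ++ˢ-fixpoint-unique (a ++ b) ab≢[] (omega-unfold (a ++ b) ab≢[]) unfolds
  where
  ba≢[] : 0 < length (b ++ a)
  ba≢[] = subst (0 <_) (length-++-comm a b) ab≢[]
  unfolds : a ++ˢ omega (b ++ a) ≗ (a ++ b) ++ˢ a ++ˢ omega (b ++ a)
  unfolds i = trans (++ˢ-cong a (λ j → trans (omega-unfold (b ++ a) ba≢[] j) (++ˢ-assoc b a _ j)) i)
                    (sym (++ˢ-assoc a b _ i))

Diverge⇒<ω : ∀ {x y} → Diverge x y → x <ω y
Diverge⇒<ω {x} {y} x⋈y@(diverge p _ _ _) =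
  <ˢ-resp-≗ (λ i → sym (omega-unfold x (nonempty p) i)) (λ i → sym (omega-unfold y (nonempty p) i))
    (Diverge⇒<ˢ x⋈y (omega x) (omega y))
  where
  nonempty : ∀ p {c r} → 0 < length (p ++ c ∷ r)
  nonempty [] = z<s
  nonempty (_ ∷ _) = z<s

infixl 8 _^^_
_^^_ : Str → ℕ → Str
x ^^ zero = []
x ^^ suc k = x ++ x ^^ k

length-^^ : ∀ x k → length (x ^^ k) ≡ k * length x
length-^^ x zero = refl
length-^^ x (suc k) = trans (length-++ x) (cong (length x +_) (length-^^ x k))

omega-^^ : ∀ x k → 0 < length x → omega x ≗ x ^^ k ++ˢ omega x
omega-^^ x zero x≢[] i = refl
omega-^^ x (suc k) x≢[] i =
  trans (omega-unfold x x≢[] i) (trans (++ˢ-cong x (omega-^^ x k x≢[]) i) (sym (++ˢ-assoc x (x ^^ k) _ i)))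

^^-long : ∀ x k → 0 < length x → k ≤ length (x ^^ k)
^^-long x k x≢[] = subst (k ≤_) (sym (length-^^ x k)) (m≤m*n k (length x) {{>-nonZero x≢[]}})

^^-snoc : ∀ (x : Str) k → x ^^ k ++ x ≡ x ^^ suc k
^^-snoc x zero = sym (++-identityʳ x)
^^-snoc x (suc k) = trans (++-assoc x (x ^^ k) x) (cong (x ++_) (^^-snoc x k))

≼-total : ∀ x y → x ≼ y ⊎ y ≼ x
≼-total [] y = inj₁ []≼
≼-total (c ∷ x) [] = inj₂ []≼
≼-total (c ∷ x) (d ∷ y) with <-cmp c d
... | tri< c<d _ _ = inj₁ (<≼ c<d)
... | tri> _ _ d<c = inj₂ (<≼ d<c)
... | tri≈ _ refl _ with ≼-total x y
...   | inj₁ x≼y = inj₁ (≡≼ x≼y)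
...   | inj₂ y≼x = inj₂ (≡≼ y≼x)

≼⇒≯ω : ∀ {x y} → 0 < length x → length x ≡ length y → x ≼ y → ¬ y <ω x
≼⇒≯ω x≢[] |x|≡|y| x≼y y<x with ≼⇒≡⊎Diverge x≼y (≤-reflexive (sym |x|≡|y|))
... | inj₁ refl = <ˢ-irrefl y<x
... | inj₂ x⋈y = <ˢ-irrefl (<ˢ-trans y<x (Diverge⇒<ω x⋈y))

-- The ω-order of x and y is decided by the lexicographic order of the equally long x^|y| and y^|x|.
≼⇒≤ω : ∀ x y → 0 < length x → 0 < length y → (x ^^ length y) ≼ (y ^^ length x) → x ≤ω y
≼⇒≤ω x y x≢[] y≢[] xʸ≼yˣ with ≼⇒≡⊎Diverge xʸ≼yˣ (≤-reflexive |yˣ|≡|xʸ|)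
  where
  |yˣ|≡|xʸ| : length (y ^^ length x) ≡ length (x ^^ length y)
  |yˣ|≡|xʸ| = trans (length-^^ y (length x)) (trans (*-comm (length x) (length y)) (sym (length-^^ x (length y))))
... | inj₁ xʸ≡yˣ = inj₂ (++ˢ-fixpoint-unique (x ^^ length y) (<-≤-trans y≢[] (^^-long x (length y) x≢[]))
                          (omega-^^ x (length y) x≢[])
                          (λ i → trans (omega-^^ y (length x) y≢[] i) (cong (λ z → (z ++ˢ omega y) i) (sym xʸ≡yˣ))))
... | inj₂ xʸ⋈yˣ = inj₁ (<ˢ-resp-≗ (λ i → sym (omega-^^ x (length y) x≢[] i))
                                    (λ i → sym (omega-^^ y (length x) y≢[] i))
                          (Diverge⇒<ˢ xʸ⋈yˣ (omega x) (omega y)))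

-- omega [] is the junk all-zero stream, which is also omega [ 0 ].
nonempty-representative : ∀ x → ∃ λ x′ → 0 < length x′ × omega x ≗ omega x′
nonempty-representative [] = [ 0 ] , z<s , λ i → sym (cong (at [ 0 ]) (n%1≡0 i))
nonempty-representative x@(_ ∷ _) = x , z<s , λ _ → refl

≤ω-total : ∀ x y → x ≤ω y ⊎ y ≤ω x
≤ω-total x y with nonempty-representative x | nonempty-representative y
... | x′ , x′≢[] , x≗x′ | y′ , y′≢[] , y≗y′ with ≼-total (x′ ^^ length y′) (y′ ^^ length x′)
...   | inj₁ xʸ≼yˣ = inj₁ (≤ˢ-resp-≗ (λ i → sym (x≗x′ i)) (λ i → sym (y≗y′ i)) (≼⇒≤ω x′ y′ x′≢[] y′≢[] xʸ≼yˣ))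
...   | inj₂ yˣ≼xʸ = inj₂ (≤ˢ-resp-≗ (λ i → sym (y≗y′ i)) (λ i → sym (x≗x′ i)) (≼⇒≤ω y′ x′ y′≢[] x′≢[] yˣ≼xʸ))

-- Rotations

Rot : Str → Str → Set
Rot w R = ∃ λ x → ∃ λ y → w ≡ x ++ y × R ≡ y ++ x

Rot-refl : ∀ w → Rot w w
Rot-refl w = [] , w , refl , sym (++-identityʳ w)

Rot-trans : ∀ {w R R′} → Rot w R → Rot R R′ → Rot w R′
Rot-trans (x , y , w≡xy , R≡yx) (x′ , y′ , R≡x′y′ , R′≡y′x′)
  with ++-equidivisible y x x′ y′ (trans (sym R≡yx) R≡x′y′)
... | inj₁ (m , x′≡ym , x≡my′) = m , y′ ++ y ,
      trans w≡xy (trans (cong (_++ y) x≡my′) (++-assoc m y′ y)) ,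
      trans R′≡y′x′ (trans (cong (y′ ++_) x′≡ym) (sym (++-assoc y′ y m)))
... | inj₂ (m , y≡x′m , y′≡mx) = x ++ x′ , m ,
      trans w≡xy (trans (cong (x ++_) y≡x′m) (sym (++-assoc x x′ m))) ,
      trans R′≡y′x′ (trans (cong (_++ x′) y′≡mx) (++-assoc m x x′))

Rot⇒↭ : ∀ {w R} → Rot w R → R ↭ w
Rot⇒↭ (x , y , refl , refl) = ↭-++-comm y x

length-Rot : ∀ {w R} → Rot w R → length R ≡ length w
length-Rot r = ↭-length (Rot⇒↭ r)

Rot⇒∈rotations : ∀ {w R} → 0 < length w → Rot w R → R ∈ rotations w
Rot⇒∈rotations {w} w≢[] (x , [] , w≡x , R≡x) =
  subst (_∈ rotations w) (trans (++-identityʳ w) (trans w≡x (trans (++-identityʳ x) (sym R≡x))))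
    (∈-map⁺ (λ i → drop i w ++ take i w) (∈-upTo⁺ w≢[]))
Rot⇒∈rotations {w} w≢[] (x , c ∷ y , refl , refl) =
  subst (_∈ rotations w) (cong₂ _++_ (drop-length-++ x (c ∷ y)) (take-length-++ x (c ∷ y)))
    (∈-map⁺ (λ i → drop i w ++ take i w)
            (∈-upTo⁺ (subst (length x <_) (sym (length-++ x)) (m<m+n (length x) z<s))))

∈rotations⇒Rot : ∀ {w R} → R ∈ rotations w → Rot w R
∈rotations⇒Rot {w} R∈ with ∈-map⁻ (λ i → drop i w ++ take i w) R∈
... | i , _ , refl = take i w , drop i w , sym (take++drop≡id i w) , refl

∈⇒Rot-lastChar : ∀ {c w} → c ∈ w → ∃ λ R → Rot w R × lastChar R ≡ c
∈⇒Rot-lastChar {c} c∈w with ∈-∃++ c∈w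
... | x , y , refl = y ++ x ++ [ c ] , (x ++ [ c ] , y , sym (++-assoc x [ c ] y) , refl) ,
                     trans (cong lastChar (sym (++-assoc y x [ c ]))) (lastChar-snoc (y ++ x) c)

-- Binary words and the morphism ψ

Bin : Str → Set
Bin = All (_≤ 1)

lastChar-Bin : ∀ {R} → Bin R → lastChar R ≤ 1
lastChar-Bin [] = z≤n
lastChar-Bin (c≤1 ∷ []) = c≤1
lastChar-Bin (_ ∷ d≤1 ∷ b) = lastChar-Bin (d≤1 ∷ b)

Bin-Rot : ∀ {w R} → Rot w R → Bin w → Bin R
Bin-Rot r = All-resp-↭ (↭-sym (Rot⇒↭ r))

binary-< : ∀ {c d} → c < d → d ≤ 1 → c ≡ 0 × d ≡ 1
binary-< (s≤s z≤n) (s≤s z≤n) = refl , refl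

-- Letters other than 0 are mapped like 1; ψ is only applied to binary words.
ψ₁ : ℕ → Str
ψ₁ zero = 0 ∷ 0 ∷ 1 ∷ []
ψ₁ (suc _) = 0 ∷ 1 ∷ []

ψ : Str → Str
ψ = concatMap ψ₁

ψ-++ : ∀ x y → ψ (x ++ y) ≡ ψ x ++ ψ y
ψ-++ = concatMap-++ ψ₁

ψ-^^ : ∀ x k → ψ (x ^^ k) ≡ ψ x ^^ k
ψ-^^ x zero = refl
ψ-^^ x (suc k) = trans (ψ-++ x (x ^^ k)) (cong (ψ x ++_) (ψ-^^ x k))

Bin-ψ : ∀ x → Bin (ψ x)
Bin-ψ [] = []
Bin-ψ (zero ∷ x) = z≤n ∷ z≤n ∷ s≤s z≤n ∷ Bin-ψ x
Bin-ψ (suc _ ∷ x) = z≤n ∷ s≤s z≤n ∷ Bin-ψ x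

Bin-^^ : ∀ {x} k → Bin x → Bin (x ^^ k)
Bin-^^ zero _ = []
Bin-^^ (suc k) b = Allₚ.++⁺ b (Bin-^^ k b)

length-ψ₁ : ∀ c → 2 ≤ length (ψ₁ c) × length (ψ₁ c) ≤ 3
length-ψ₁ zero = s≤s (s≤s z≤n) , ≤-refl
length-ψ₁ (suc _) = ≤-refl , s≤s (s≤s z≤n)

length-ψ-≥ : ∀ x → 2 * length x ≤ length (ψ x)
length-ψ-≥ [] = z≤n
length-ψ-≥ (c ∷ x) = begin
  2 * suc (length x)           ≡⟨ *-suc 2 (length x) ⟩
  2 + 2 * length x             ≤⟨ +-mono-≤ (proj₁ (length-ψ₁ c)) (length-ψ-≥ x) ⟩
  length (ψ₁ c) + length (ψ x) ≡⟨ length-++ (ψ₁ c) ⟨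
  length (ψ (c ∷ x))           ∎
  where open ≤-Reasoning

length-ψ-≤ : ∀ x → length (ψ x) ≤ 3 * length x
length-ψ-≤ [] = z≤n
length-ψ-≤ (c ∷ x) = begin
  length (ψ (c ∷ x))           ≡⟨ length-++ (ψ₁ c) ⟩
  length (ψ₁ c) + length (ψ x) ≤⟨ +-mono-≤ (proj₂ (length-ψ₁ c)) (length-ψ-≤ x) ⟩
  3 + 3 * length x             ≡⟨ *-suc 3 (length x) ⟨
  3 * suc (length x)           ∎
  where open ≤-Reasoning

ψ₁-nonempty : ∀ c → 0 < length (ψ₁ c)
ψ₁-nonempty zero = z<s
ψ₁-nonempty (suc _) = z<s

lastChar-ψ₁ : ∀ c → lastChar (ψ₁ c) ≡ 1
lastChar-ψ₁ zero = refl
lastChar-ψ₁ (suc _) = refl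

ψ-nonempty : ∀ S → 0 < length S → 0 < length (ψ S)
ψ-nonempty (zero ∷ _) _ = z<s
ψ-nonempty (suc _ ∷ _) _ = z<s

lastChar-ψ : ∀ S → 0 < length S → lastChar (ψ S) ≡ 1
lastChar-ψ (c ∷ []) _ = trans (cong lastChar (++-identityʳ (ψ₁ c))) (lastChar-ψ₁ c)
lastChar-ψ (c ∷ d ∷ S) _ = trans (lastChar-++ (ψ₁ c) (ψ (d ∷ S)) (ψ-nonempty (d ∷ S) z<s)) (lastChar-ψ (d ∷ S) z<s)

ψ-concat : ∀ us → ψ (concat us) ≡ concat (map ψ us)
ψ-concat [] = refl
ψ-concat (u ∷ us) = trans (ψ-++ u (concat us)) (cong (ψ u ++_) (ψ-concat us))

ψ-Rot : ∀ {u R} → Rot u R → Rot (ψ u) (ψ R)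
ψ-Rot (x , y , refl , refl) = ψ x , ψ y , ψ-++ x y , ψ-++ y x

ψ-Diverge : ∀ {x y} → Bin y → Diverge x y → Diverge (ψ x) (ψ y)
ψ-Diverge by (diverge p r r′ c<d) with binary-< c<d (All.head (Allₚ.++⁻ʳ p by))
... | refl , refl = subst₂ Diverge (sym (ψ-++ p (0 ∷ r))) (sym (ψ-++ p (1 ∷ r′)))
                      (Diverge-++ˡ (ψ p) (Diverge-++ˡ [ 0 ] (diverge [] (1 ∷ ψ r) (ψ r′) z<s)))

ψ-mono-<ω : ∀ {x y} → Bin y → 0 < length x → 0 < length y → x <ω y → ψ x <ω ψ y
ψ-mono-<ω {x} {y} by x≢[] y≢[] x<y@(i , _) =
  <ˢ-resp-≗ (λ j → sym (omega-^^ (ψ x) k (ψ-nonempty x x≢[]) j))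
            (λ j → sym (omega-^^ (ψ y) k (ψ-nonempty y y≢[]) j))
    (Diverge⇒<ˢ (subst₂ Diverge (ψ-^^ x k) (ψ-^^ y k) (ψ-Diverge (Bin-^^ k by) xᵏ⋈yᵏ)) _ _)
  where
  k = suc i
  -- The first difference of x^∞ and y^∞ already occurs within x^k and y^k.
  xᵏ⋈yᵏ : Diverge (x ^^ k) (y ^^ k)
  xᵏ⋈yᵏ = <ˢ⇒Diverge (x ^^ k) (y ^^ k) (<ˢ-resp-≗ (omega-^^ x k x≢[]) (omega-^^ y k y≢[]) x<y)
            (^^-long x k x≢[]) (^^-long y k y≢[])

ψ-mono-≺ : ∀ {u v} → Bin v → u ≺ v → length v < length u → ψ u ≺ ψ v
ψ-mono-≺ bv (u≼v , u≢v) v<u with ≼⇒≡⊎Diverge u≼v (<⇒≤ v<u)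
... | inj₁ u≡v = ⊥-elim (u≢v u≡v)
... | inj₂ u⋈v = Diverge⇒≺ (ψ-Diverge bv u⋈v)

++-monoʳ-≼ : ∀ p {xs ys} → xs ≼ ys → (p ++ xs) ≼ (p ++ ys)
++-monoʳ-≼ [] le = le
++-monoʳ-≼ (c ∷ p) le = ≡≼ (++-monoʳ-≼ p le)

ψ-mono-≼ : ∀ {x y} → Bin y → x ≼ y → ψ x ≼ ψ y
ψ-mono-≼ _ []≼ = []≼
ψ-mono-≼ (d≤1 ∷ _) (<≼ c<d) with binary-< c<d d≤1
... | refl , refl = ≡≼ (<≼ z<s)
ψ-mono-≼ (_ ∷ by) (≡≼ {c} x≼y) = ++-monoʳ-≼ (ψ₁ c) (ψ-mono-≼ by x≼y)

ψ-starts-0 : ∀ u → 0 < length u → ∃ λ t → ψ u ≡ 0 ∷ t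
ψ-starts-0 (zero ∷ u) _ = _ , refl
ψ-starts-0 (suc _ ∷ u) _ = _ , refl

ψ≺1∷ : ∀ u z → 0 < length u → ψ u ≺ (1 ∷ z)
ψ≺1∷ u z u≢[] with ψ-starts-0 u u≢[]
... | t , eq = subst (_≺ (1 ∷ z)) (sym eq) (Diverge⇒≺ (diverge [] t z z<s))

-- ψ′ R is ψ R without its final 01.
ψ′ : Str → Str
ψ′ [] = []
ψ′ (c ∷ d ∷ r) = ψ₁ c ++ ψ′ (d ∷ r)
ψ′ (zero ∷ []) = [ 0 ]
ψ′ (suc _ ∷ []) = []

Φ : Str → Str
Φ R = 0 ∷ 1 ∷ ψ′ R

ψ′-++-01 : ∀ R → 0 < length R → ψ′ R ++ 0 ∷ 1 ∷ [] ≡ ψ R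
ψ′-++-01 (zero ∷ []) _ = refl
ψ′-++-01 (suc _ ∷ []) _ = refl
ψ′-++-01 (c ∷ d ∷ r) _ = trans (++-assoc (ψ₁ c) (ψ′ (d ∷ r)) _) (cong (ψ₁ c ++_) (ψ′-++-01 (d ∷ r) z<s))

ψ′-snoc : ∀ s c → ψ′ (s ++ [ c ]) ≡ ψ s ++ ψ′ [ c ]
ψ′-snoc [] c = refl
ψ′-snoc (a ∷ []) c = cong (_++ ψ′ [ c ]) (sym (++-identityʳ (ψ₁ a)))
ψ′-snoc (a ∷ s@(_ ∷ _)) c = trans (cong (ψ₁ a ++_) (ψ′-snoc s c)) (sym (++-assoc (ψ₁ a) (ψ s) _))

ψ-suc∷ : ∀ k s → ψ (suc k ∷ s) ≡ Φ (s ++ [ suc k ])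
ψ-suc∷ k s = cong (λ t → 0 ∷ 1 ∷ t) (sym (trans (ψ′-snoc s (suc k)) (++-identityʳ (ψ s))))

Rot-ψ-Φ : ∀ R → 0 < length R → Rot (ψ R) (Φ R)
Rot-ψ-Φ R R≢[] = ψ′ R , 0 ∷ 1 ∷ [] , sym (ψ′-++-01 R R≢[]) , refl

omega-Φ : ∀ R → 0 < length R → omega (Φ R) ≗ (0 ∷ 1 ∷ []) ++ˢ omega (ψ R)
omega-Φ R R≢[] i = trans (omega-rotate (0 ∷ 1 ∷ []) (ψ′ R) z<s i)
                         (++ˢ-cong (0 ∷ 1 ∷ []) (λ j → cong (λ t → omega t j) (ψ′-++-01 R R≢[])) i)

Φ-mono-<ω : ∀ {R R′} → Bin R′ → 0 < length R → 0 < length R′ → R <ω R′ → Φ R <ω Φ R′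
Φ-mono-<ω {R} {R′} bR′ R≢[] R′≢[] R<R′ =
  <ˢ-resp-≗ (λ i → sym (omega-Φ R R≢[] i)) (λ i → sym (omega-Φ R′ R′≢[] i))
    (++ˢ-monoʳ-<ˢ (0 ∷ 1 ∷ []) (ψ-mono-<ω {R} {R′} bR′ R≢[] R′≢[] R<R′))

Bin-Φ : ∀ R → 0 < length R → Bin (Φ R)
Bin-Φ R R≢[] = z≤n ∷ s≤s z≤n ∷ Allₚ.++⁻ˡ (ψ′ R) (subst Bin (sym (ψ′-++-01 R R≢[])) (Bin-ψ R))

lastChar-++-ψ′ : ∀ p R → Bin R → 0 < length R → lastChar p ≡ 1 → lastChar (p ++ ψ′ R) ≡ lastChar R
lastChar-++-ψ′ p (zero ∷ []) _ _ _ = lastChar-snoc p 0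
lastChar-++-ψ′ p (suc zero ∷ []) _ _ p↑1 = trans (cong lastChar (++-identityʳ p)) p↑1
lastChar-++-ψ′ p (suc (suc _) ∷ []) (s≤s () ∷ _) _ _
lastChar-++-ψ′ p (c ∷ d ∷ r) (_ ∷ b) _ p↑1 =
  trans (cong lastChar (sym (++-assoc p (ψ₁ c) (ψ′ (d ∷ r)))))
        (lastChar-++-ψ′ (p ++ ψ₁ c) (d ∷ r) b z<s
          (trans (lastChar-++ p (ψ₁ c) (ψ₁-nonempty c)) (lastChar-ψ₁ c)))

lastChar-Φ : ∀ R → Bin R → 0 < length R → lastChar (Φ R) ≡ lastChar R
lastChar-Φ R b R≢[] = lastChar-++-ψ′ (0 ∷ 1 ∷ []) R b R≢[] refl

Diverge-1^ : ∀ R → Bin R → 0 ∈ R → Diverge R ([ 1 ] ^^ length R)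
Diverge-1^ (zero ∷ r) _ _ = diverge [] r _ z<s
Diverge-1^ (suc zero ∷ r) (_ ∷ br) (there 0∈r) = Diverge-++ˡ [ 1 ] (Diverge-1^ r br 0∈r)
Diverge-1^ (suc (suc _) ∷ _) (s≤s () ∷ _) _

<ω-[1] : ∀ {R} → Bin R → 0 ∈ R → R <ω [ 1 ]
<ω-[1] {R} bR 0∈R =
  <ˢ-resp-≗ (λ i → sym (omega-unfold R (∈⇒nonempty 0∈R) i)) (λ i → sym (omega-^^ [ 1 ] (length R) z<s i))
    (Diverge⇒<ˢ (Diverge-1^ R bR 0∈R) (omega R) (omega [ 1 ]))

Φ<ω01 : ∀ {R} → Bin R → 0 ∈ R → Φ R <ω (0 ∷ 1 ∷ [])
Φ<ω01 {R} bR 0∈R = Φ-mono-<ω {R} {[ 1 ]} (s≤s z≤n ∷ []) (∈⇒nonempty 0∈R) z<s (<ω-[1] bR 0∈R)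

-- Rotations of ψ w

-- Where a factorisation ψ w = X ++ Y cuts ψ w: between two letter images or inside one of them.
data ψ-Cut : Str → Str → Str → Set where
  boundary : ∀ x y → ψ-Cut (x ++ y) (ψ x) (ψ y)
  0∣01 : ∀ x y → ψ-Cut (x ++ 0 ∷ y) (ψ x ++ [ 0 ]) (0 ∷ 1 ∷ ψ y)
  00∣1 : ∀ x y → ψ-Cut (x ++ 0 ∷ y) (ψ x ++ 0 ∷ 0 ∷ []) (1 ∷ ψ y)
  0∣1 : ∀ x k y → ψ-Cut (x ++ suc k ∷ y) (ψ x ++ [ 0 ]) (1 ∷ ψ y)

ψ-Cut-reassoc : ∀ c x u {w Y} → ψ-Cut w ((ψ₁ c ++ ψ x) ++ u) Y → ψ-Cut w (ψ₁ c ++ ψ x ++ u) Y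
ψ-Cut-reassoc c x u {w} {Y} = subst (λ X → ψ-Cut w X Y) (++-assoc (ψ₁ c) (ψ x) u)

ψ-Cut-∷ : ∀ c {w X Y} → ψ-Cut w X Y → ψ-Cut (c ∷ w) (ψ₁ c ++ X) Y
ψ-Cut-∷ c (boundary x y) = boundary (c ∷ x) y
ψ-Cut-∷ c (0∣01 x y) = ψ-Cut-reassoc c x _ (0∣01 (c ∷ x) y)
ψ-Cut-∷ c (00∣1 x y) = ψ-Cut-reassoc c x _ (00∣1 (c ∷ x) y)
ψ-Cut-∷ c (0∣1 x k y) = ψ-Cut-reassoc c x _ (0∣1 (c ∷ x) k y)

ψ₁-cut : ∀ c w X m → ψ₁ c ≡ X ++ m → ψ-Cut (c ∷ w) X (m ++ ψ w)
ψ₁-cut zero w [] _ refl = boundary [] (0 ∷ w)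
ψ₁-cut zero w (0 ∷ []) _ refl = 0∣01 [] w
ψ₁-cut zero w (0 ∷ 0 ∷ []) _ refl = 00∣1 [] w
ψ₁-cut zero w (0 ∷ 0 ∷ 1 ∷ []) _ refl = boundary [ 0 ] w
ψ₁-cut (suc k) w [] _ refl = boundary [] (suc k ∷ w)
ψ₁-cut (suc k) w (0 ∷ []) _ refl = 0∣1 [] k w
ψ₁-cut (suc k) w (0 ∷ 1 ∷ []) _ refl = boundary [ suc k ] w

ψ-cut : ∀ w X Y → ψ w ≡ X ++ Y → ψ-Cut w X Y
ψ-cut [] [] [] _ = boundary [] []
ψ-cut (c ∷ w) X Y eq with ++-equidivisible (ψ₁ c) (ψ w) X Y eq
... | inj₁ (m , refl , ψw≡mY) = ψ-Cut-∷ c (ψ-cut w m Y ψw≡mY)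
... | inj₂ (m , ψ₁c≡Xm , refl) = ψ₁-cut c w X m ψ₁c≡Xm

-- The shapes of a rotation of ψ w, according to its first two letters.
data ψ-Rotation (w : Str) : Str → Set where
  via-ψ : ∀ s → ψ-Rotation w (ψ (0 ∷ s))
  via-Φ : ∀ {S} → Rot w S → 0 < length S → ψ-Rotation w (Φ S)
  via-1 : ∀ z → ψ-Rotation w (1 ∷ z ++ [ 0 ])

ψ-Rotation-ψ : ∀ {w} S → Rot w S → 0 < length S → ψ-Rotation w (ψ S)
ψ-Rotation-ψ (zero ∷ s) _ _ = via-ψ s
ψ-Rotation-ψ {w} (suc k ∷ s) r _ =
  subst (ψ-Rotation w) (sym (ψ-suc∷ k s))
    (via-Φ (Rot-trans r ([ suc k ] , s , refl , refl)) (snoc-nonempty s (suc k)))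

ψ-Rotation-of : ∀ w {R} → 0 < length w → Rot (ψ w) R → ψ-Rotation w R
ψ-Rotation-of w w≢[] (X , Y , ψw≡XY , refl) with ψ-cut w X Y ψw≡XY
... | boundary x y = subst (ψ-Rotation (x ++ y)) (ψ-++ y x)
                       (ψ-Rotation-ψ (y ++ x) (x , y , refl , refl) (subst (0 <_) (length-++-comm x y) w≢[]))
... | 0∣01 x y = subst (ψ-Rotation (x ++ 0 ∷ y)) Φ-yx0
                   (via-Φ {S = (y ++ x) ++ [ 0 ]} (x ++ [ 0 ] , y , sym (++-assoc x [ 0 ] y) , ++-assoc y x [ 0 ])
                          (snoc-nonempty (y ++ x) 0))
  where
  Φ-yx0 : Φ ((y ++ x) ++ [ 0 ]) ≡ 0 ∷ 1 ∷ ψ y ++ ψ x ++ [ 0 ]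
  Φ-yx0 = cong (λ t → 0 ∷ 1 ∷ t)
            (trans (ψ′-snoc (y ++ x) 0) (trans (cong (_++ [ 0 ]) (ψ-++ y x)) (++-assoc (ψ y) (ψ x) [ 0 ])))
... | 00∣1 x y = subst (ψ-Rotation (x ++ 0 ∷ y)) (cong (1 ∷_) reassoc) (via-1 (ψ y ++ ψ x ++ [ 0 ]))
  where
  reassoc : (ψ y ++ ψ x ++ [ 0 ]) ++ [ 0 ] ≡ ψ y ++ ψ x ++ 0 ∷ 0 ∷ []
  reassoc = trans (++-assoc (ψ y) _ [ 0 ]) (cong (ψ y ++_) (++-assoc (ψ x) [ 0 ] [ 0 ]))
... | 0∣1 x k y =
  subst (ψ-Rotation (x ++ suc k ∷ y)) (cong (1 ∷_) (++-assoc (ψ y) (ψ x) [ 0 ])) (via-1 (ψ y ++ ψ x))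

OnesPrecedeZeros : Str → Set
OnesPrecedeZeros w = ∀ {R R′} → Rot w R → Rot w R′ → lastChar R ≡ 1 → lastChar R′ ≡ 0 → R <ω R′

OnesPrecedeZeros-Rot : ∀ {w w′} → Rot w w′ → OnesPrecedeZeros w → OnesPrecedeZeros w′
OnesPrecedeZeros-Rot r sep rR rR′ = sep (Rot-trans r rR) (Rot-trans r rR′)

OnesPrecedeZeros-0 : OnesPrecedeZeros [ 0 ]
OnesPrecedeZeros-0 rR _ R↑1 _ with ↭-singleton-inv (Rot⇒↭ rR)
... | refl = ⊥-elim (1+n≢0 (sym R↑1))

OnesPrecedeZeros-ψ : ∀ {w} → Bin w → 0 < length w → OnesPrecedeZeros w → OnesPrecedeZeros (ψ w)
OnesPrecedeZeros-ψ {w} bw w≢[] sep rR rR′ R↑1 R′↑0 with ψ-Rotation-of w w≢[] rR | ψ-Rotation-of w w≢[] rR′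
... | _ | via-ψ s = ⊥-elim (1+n≢0 (trans (sym (lastChar-ψ (0 ∷ s) z<s)) R′↑0))
... | via-1 z | _ = ⊥-elim (1+n≢0 (trans (sym R↑1) (lastChar-snoc (1 ∷ z) 0)))
... | via-ψ s | via-Φ {S′} _ _ = Diverge⇒<ω (Diverge-++ˡ [ 0 ] (diverge [] (1 ∷ ψ s) (ψ′ S′) z<s))
... | via-ψ s | via-1 z = Diverge⇒<ω (diverge [] (0 ∷ 1 ∷ ψ s) (z ++ [ 0 ]) z<s)
... | via-Φ {S} _ _ | via-1 z = Diverge⇒<ω (diverge [] (1 ∷ ψ′ S) (z ++ [ 0 ]) z<s)
... | via-Φ {S} rS S≢[] | via-Φ {S′} rS′ S′≢[] = Φ-mono-<ω {S} {S′} (Bin-Rot rS′ bw) S≢[] S′≢[] (sep rS rS′ S↑1 S′↑0)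
  where
  S↑1 : lastChar S ≡ 1
  S↑1 = trans (sym (lastChar-Φ S (Bin-Rot rS bw) S≢[])) R↑1
  S′↑0 : lastChar S′ ≡ 0
  S′↑0 = trans (sym (lastChar-Φ S′ (Bin-Rot rS′ bw) S′≢[])) R′↑0

-- Runs

runs-0∷ : ∀ t → Linked _≥_ (0 ∷ t) → runs (0 ∷ t) ≡ 1
runs-0∷ [] _ = refl
runs-0∷ (.0 ∷ t) (z≤n ∷ l) = runs-0∷ t l

runs-1∷ : ∀ t → Bin t → Linked _≥_ (1 ∷ t) → 0 ∈ t → runs (1 ∷ t) ≡ 2
runs-1∷ (zero ∷ t) _ (_ ∷ l) _ = cong suc (runs-0∷ t l)
runs-1∷ (suc zero ∷ t) (_ ∷ bt) (_ ∷ l) (there 0∈t) = runs-1∷ t bt l 0∈t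
runs-1∷ (suc (suc _) ∷ _) (s≤s () ∷ _) _ _

runs-nonincreasing-binary : ∀ {s} → Bin s → Linked _≥_ s → 0 ∈ s → 1 ∈ s → runs s ≡ 2
runs-nonincreasing-binary {zero ∷ t} _ l _ (there 1∈t) = ⊥-elim (no-1-after-0 t l 1∈t)
  where
  no-1-after-0 : ∀ t → Linked _≥_ (0 ∷ t) → ¬ 1 ∈ t
  no-1-after-0 (.0 ∷ t) (z≤n ∷ l) (there 1∈t) = no-1-after-0 t l 1∈t
runs-nonincreasing-binary {suc zero ∷ t} (_ ∷ bt) l (there 0∈t) _ = runs-1∷ t bt l 0∈t
runs-nonincreasing-binary {suc (suc _) ∷ _} (s≤s () ∷ _) _ _ _

differ : ℕ → ℕ → ℕ
differ x y = if x ≡ᵇ y then 0 else 1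

changes : ℕ → Str → ℕ
changes x [] = 0
changes x (y ∷ t) = differ x y + changes y t

runs≡suc-changes : ∀ x t → runs (x ∷ t) ≡ suc (changes x t)
runs≡suc-changes x [] = refl
runs≡suc-changes x (y ∷ t) = trans (cong (differ x y +_) (runs≡suc-changes y t)) (+-suc (differ x y) (changes y t))

differ≤1 : ∀ x y → differ x y ≤ 1
differ≤1 x y with x ≡ᵇ y
... | true = z≤n
... | false = ≤-refl

differ-triangle : ∀ x y z → differ x z ≤ differ x y + differ y z
differ-triangle x y z with x ≡ᵇ y in x≡ᵇy
... | false = ≤-trans (differ≤1 x z) (m≤m+n 1 (differ y z))
... | true with ≡ᵇ⇒≡ x y (subst T (sym x≡ᵇy) _)
...   | refl = ≤-refl

changes-triangle : ∀ x y t → changes x t ≤ differ x y + changes y t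
changes-triangle x y [] = z≤n
changes-triangle x y (z ∷ t) =
  ≤-trans (+-monoˡ-≤ (changes z t) (differ-triangle x y z)) (≤-reflexive (+-assoc (differ x y) (differ y z) (changes z t)))

changes-mono-⊆ : ∀ {s t} → s ⊆ t → ∀ x → changes x s ≤ changes x t
changes-mono-⊆ [] x = z≤n
changes-mono-⊆ {t = _ ∷ t} (y ∷ʳ s⊆t) x = ≤-trans (changes-mono-⊆ s⊆t x) (changes-triangle x y t)
changes-mono-⊆ (refl ∷ s⊆t) x = +-monoʳ-≤ (differ x _) (changes-mono-⊆ s⊆t _)

runs-mono-⊆ : ∀ {s t} → s ⊆ t → runs s ≤ runs t
runs-mono-⊆ [] = z≤n
runs-mono-⊆ {t = _ ∷ t} (y ∷ʳ s⊆t) = ≤-trans (runs-mono-⊆ s⊆t) (runs-∷ y t)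
  where
  runs-∷ : ∀ y t → runs t ≤ runs (y ∷ t)
  runs-∷ y [] = z≤n
  runs-∷ y (z ∷ t) = m≤n+m (runs (z ∷ t)) (differ y z)
runs-mono-⊆ {x ∷ s} {.x ∷ t} (refl ∷ s⊆t) =
  subst₂ _≤_ (sym (runs≡suc-changes x s)) (sym (runs≡suc-changes x t)) (s≤s (changes-mono-⊆ s⊆t x))

-- The Burrows–Wheeler transform

binary-≥ : ∀ {c d} → c ≤ 1 → d ≤ 1 → ¬ (c ≡ 0 × d ≡ 1) → d ≤ c
binary-≥ {zero} {zero} _ _ _ = z≤n
binary-≥ {zero} {suc zero} _ _ not01 = ⊥-elim (not01 (refl , refl))
binary-≥ {zero} {suc (suc _)} _ (s≤s ()) _
binary-≥ {suc zero} _ d≤1 _ = d≤1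
binary-≥ {suc (suc _)} (s≤s ()) _ _

lastChars-nonincreasing : ∀ {w} → Bin w → 0 < length w → OnesPrecedeZeros w →
  ∀ {L} → All (Rot w) L → Linked _≼_ L → Linked _≥_ (map lastChar L)
lastChars-nonincreasing {w} bw w≢[] sep rots sorted = Linkedₚ.map⁺ (adjacent rots sorted)
  where
  adjacent : ∀ {L} → All (Rot w) L → Linked _≼_ L → Linked (λ R R′ → lastChar R ≥ lastChar R′) L
  adjacent [] [] = []
  adjacent (_ ∷ []) [-] = [-]
  adjacent (rR ∷ rR′ ∷ rots) (R≼R′ ∷ sorted) =
    binary-≥ (lastChar-Bin (Bin-Rot rR bw)) (lastChar-Bin (Bin-Rot rR′ bw))
      (λ (R↑0 , R′↑1) → ≼⇒≯ω (subst (0 <_) (sym (length-Rot rR)) w≢[])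
                               (trans (length-Rot rR) (sym (length-Rot rR′))) R≼R′ (sep rR′ rR R′↑1 R↑0))
    ∷ adjacent (rR′ ∷ rots) sorted

module ≼-Sort = InsertionSort _≼_ ≼-total

BWT-runs≡2 : ∀ {w} → Bin w → OnesPrecedeZeros w → 0 ∈ w → 1 ∈ w → Σ Str λ s → IsBWT w s × runs s ≡ 2
BWT-runs≡2 {w} bw sep 0∈w 1∈w =
  map lastChar L , (L , ≼-Sort.sort-↭ (rotations w) , sorted , refl) ,
  runs-nonincreasing-binary (Allₚ.map⁺ (All.map (λ rR → lastChar-Bin (Bin-Rot rR bw)) rots))
    (lastChars-nonincreasing bw (∈⇒nonempty 0∈w) sep rots sorted) (lastChar-∈ 0∈w) (lastChar-∈ 1∈w)
  where
  L = ≼-Sort.sort (rotations w)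
  sorted : Linked _≼_ L
  sorted = ≼-Sort.sort-sorted (rotations w)
  rots : All (Rot w) L
  rots = All-resp-↭ (↭-sym (≼-Sort.sort-↭ (rotations w))) (All.tabulate ∈rotations⇒Rot)
  lastChar-∈ : ∀ {c} → c ∈ w → c ∈ map lastChar L
  lastChar-∈ c∈w with ∈⇒Rot-lastChar c∈w
  ... | R , rR , R↑c = subst (_∈ map lastChar L) R↑c
                         (∈-map⁺ lastChar (∈-resp-↭ (↭-sym (≼-Sort.sort-↭ (rotations w)))
                                                      (Rot⇒∈rotations (∈⇒nonempty c∈w) rR)))

-- Lyndon words

Lyndon-starts-0 : ∀ x y → IsLyndon (x ++ 0 ∷ y) → ∃ λ t → x ++ 0 ∷ y ≡ 0 ∷ t
Lyndon-starts-0 [] y _ = y , refl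
Lyndon-starts-0 (a ∷ x) y (_ , below-suffixes) with proj₁ (below-suffixes (a ∷ x) (0 ∷ y) (λ ()) (λ ()) refl)
... | ≡≼ _ = x ++ 0 ∷ y , refl

Lyndon-[_] : ∀ c → IsLyndon [ c ]
Lyndon-[ c ] = (λ ()) , no-proper-suffix
  where
  no-proper-suffix : ∀ p s → p ≢ [] → s ≢ [] → [ c ] ≡ p ++ s → [ c ] ≺ s
  no-proper-suffix [] s p≢[] _ _ = ⊥-elim (p≢[] refl)
  no-proper-suffix (a ∷ p) s _ s≢[] eq = ⊥-elim (s≢[] (++-conicalʳ p s (sym (proj₂ (∷-injective eq)))))

ψ-Lyndon-below-suffixes : ∀ u → Bin u → IsLyndon u → ∀ p s → p ≢ [] → s ≢ [] → ψ u ≡ p ++ s → ψ u ≺ s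
ψ-Lyndon-below-suffixes u bu (u≢[] , below-suffixes) p s p≢[] s≢[] eq with ψ-cut u p s eq
... | boundary x y = ψ-mono-≺ (Allₚ.++⁻ʳ x bu) (below-suffixes x y x≢[] y≢[] refl)
                       (subst (length y <_) (sym (length-++ x)) (m<n+m (length y) (≢[]⇒nonempty x≢[])))
  where
  x≢[] : x ≢ []
  x≢[] refl = p≢[] refl
  y≢[] : y ≢ []
  y≢[] refl = s≢[] refl
... | 0∣01 x y with Lyndon-starts-0 x y (u≢[] , below-suffixes)
...   | t , eq′ = subst (_≺ (0 ∷ 1 ∷ ψ y)) (cong ψ (sym eq′))
                      (Diverge⇒≺ (Diverge-++ˡ [ 0 ] (diverge [] (1 ∷ ψ t) (ψ y) z<s)))
ψ-Lyndon-below-suffixes u bu (u≢[] , _) p s p≢[] s≢[] eq | 00∣1 x y = ψ≺1∷ u (ψ y) (≢[]⇒nonempty u≢[])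
ψ-Lyndon-below-suffixes u bu (u≢[] , _) p s p≢[] s≢[] eq | 0∣1 x k y = ψ≺1∷ u (ψ y) (≢[]⇒nonempty u≢[])

ψ-Lyndon : ∀ {u} → Bin u → IsLyndon u → IsLyndon (ψ u)
ψ-Lyndon {u} bu ly@(u≢[] , _) = ψu≢[] , ψ-Lyndon-below-suffixes u bu ly
  where
  ψu≢[] : ψ u ≢ []
  ψu≢[] eq with ψ-starts-0 u (≢[]⇒nonempty u≢[])
  ... | t , eq′ with trans (sym eq) eq′
  ...   | ()

-- The words W j

leading : ℕ → List Str
leading zero = []
leading (suc j) = (0 ∷ 1 ∷ []) ∷ map ψ (leading j)

factors : ℕ → List Str
factors j = leading j ++ [ [ 0 ] ]

W : ℕ → Str
W j = concat (factors j)

Bin-leading : ∀ j → All Bin (leading j)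
Bin-leading zero = []
Bin-leading (suc j) = (z≤n ∷ s≤s z≤n ∷ []) ∷ Allₚ.map⁺ (All.universal Bin-ψ (leading j))

Lyndon-leading : ∀ j → All IsLyndon (leading j)
Lyndon-leading zero = []
Lyndon-leading (suc j) =
  ψ-Lyndon (s≤s z≤n ∷ []) Lyndon-[ 1 ] ∷
  Allₚ.map⁺ (All.zipWith (λ (b , ly) → ψ-Lyndon b ly) (Bin-leading j , Lyndon-leading j))

StartsWith0 : Str → Set
StartsWith0 v = ∃ λ t → v ≡ 0 ∷ t

starts-0-leading : ∀ j → All StartsWith0 (leading j)
starts-0-leading zero = []
starts-0-leading (suc j) =
  (_ , refl) ∷ Allₚ.map⁺ (All.map (λ {u} (u≢[] , _) → ψ-starts-0 u (≢[]⇒nonempty u≢[])) (Lyndon-leading j))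

nonincreasing-leading : ∀ j → Linked (λ a b → b ≼ a) (leading j)
nonincreasing-leading zero = []
nonincreasing-leading (suc j) =
  Linked-∷⁺ (Allₚ.map⁺ (All.map (λ { (_ , refl) → ≡≼ (<≼ z<s) }) (starts-0-leading j)))
    (Linkedₚ.map⁺ (ψ-nonincreasing (Bin-leading j) (nonincreasing-leading j)))
  where
  ψ-nonincreasing : ∀ {us} → All Bin us → Linked (λ a b → b ≼ a) us → Linked (λ a b → ψ b ≼ ψ a) us
  ψ-nonincreasing [] [] = []
  ψ-nonincreasing (_ ∷ []) [-] = [-]
  ψ-nonincreasing {a ∷ b ∷ _} (ba ∷ bs) (b≼a ∷ sorted) = ψ-mono-≼ {b} {a} ba b≼a ∷ ψ-nonincreasing bs sorted

LyndonFactorization-W : ∀ j → IsLyndonFactorization (W j) (factors j)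
LyndonFactorization-W j =
  refl , Allₚ.++⁺ (Lyndon-leading j) (Lyndon-[ 0 ] ∷ []) ,
  Linked-++-∷ (nonincreasing-leading j) (All.map (λ { (_ , refl) → ≡≼ []≼ }) (starts-0-leading j)) [-]

W-snoc : ∀ j → W j ≡ concat (leading j) ++ [ 0 ]
W-snoc j = sym (concat-++ (leading j) [ [ 0 ] ])

W-nonempty : ∀ j → 0 < length (W j)
W-nonempty j = subst (λ w → 0 < length w) (sym (W-snoc j)) (snoc-nonempty (concat (leading j)) 0)

W-suc : ∀ j → W (suc j) ≡ Φ (W j)
W-suc j = cong (λ t → 0 ∷ 1 ∷ t) (begin
  concat (map ψ (leading j) ++ [ [ 0 ] ]) ≡⟨ W-snoc′ ⟩
  concat (map ψ (leading j)) ++ [ 0 ]     ≡⟨ cong (_++ [ 0 ]) (ψ-concat (leading j)) ⟨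
  ψ (concat (leading j)) ++ [ 0 ]         ≡⟨ ψ′-snoc (concat (leading j)) 0 ⟨
  ψ′ (concat (leading j) ++ [ 0 ])        ≡⟨ cong ψ′ (W-snoc j) ⟨
  ψ′ (W j)                                ∎)
  where
  open ≡-Reasoning
  W-snoc′ : concat (map ψ (leading j) ++ [ [ 0 ] ]) ≡ concat (map ψ (leading j)) ++ [ 0 ]
  W-snoc′ = sym (concat-++ (map ψ (leading j)) [ [ 0 ] ])

Rot-ψ-W : ∀ j → Rot (ψ (W j)) (W (suc j))
Rot-ψ-W j = subst (Rot (ψ (W j))) (sym (W-suc j)) (Rot-ψ-Φ (W j) (W-nonempty j))

Bin-W : ∀ j → Bin (W j)
Bin-W zero = z≤n ∷ []
Bin-W (suc j) = Bin-Rot (Rot-ψ-W j) (Bin-ψ (W j))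

OnesPrecedeZeros-W : ∀ j → OnesPrecedeZeros (W j)
OnesPrecedeZeros-W zero = OnesPrecedeZeros-0
OnesPrecedeZeros-W (suc j) =
  OnesPrecedeZeros-Rot (Rot-ψ-W j) (OnesPrecedeZeros-ψ (Bin-W j) (W-nonempty j) (OnesPrecedeZeros-W j))

BWT-W-runs≡2 : ∀ j → Σ Str λ s → IsBWT (W (suc j)) s × runs s ≡ 2
BWT-W-runs≡2 j = BWT-runs≡2 (Bin-W (suc j)) (OnesPrecedeZeros-W (suc j)) (here refl) (there (here refl))

length-W-suc : ∀ j → length (W (suc j)) ≡ length (ψ (W j))
length-W-suc j = length-Rot (Rot-ψ-W j)

j<length-W : ∀ j → j < length (W j)
j<length-W zero = z<s
j<length-W (suc j) = ≤-trans (s≤s (j<length-W j)) (subst (length (W j) <_) (sym (length-W-suc j)) |W|<|ψW|)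
  where
  |W|<|ψW| : length (W j) < length (ψ (W j))
  |W|<|ψW| = <-≤-trans (m<m+n (length (W j)) (subst (0 <_) (sym (+-identityʳ (length (W j)))) (W-nonempty j)))
                       (length-ψ-≥ (W j))

length-W≤3^ : ∀ j → length (W j) ≤ 3 ^ j
length-W≤3^ zero = ≤-refl
length-W≤3^ (suc j) =
  subst (_≤ 3 ^ suc j) (sym (length-W-suc j)) (≤-trans (length-ψ-≤ (W j)) (*-monoʳ-≤ 3 (length-W≤3^ j)))

-- The bijective Burrows–Wheeler transform of W j

chain : ℕ → List Str
chain zero = []
chain (suc j) = map Φ (chain j) ++ (0 ∷ 1 ∷ []) ∷ (1 ∷ 0 ∷ []) ∷ []

0∈-chain : ∀ j → All (0 ∈_) (chain j)
0∈-chain zero = []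
0∈-chain (suc j) =
  Allₚ.++⁺ (Allₚ.map⁺ (All.universal (λ _ → here refl) (chain j))) (here refl ∷ there (here refl) ∷ [])

Bin-chain : ∀ j → All Bin (chain j)
Bin-chain zero = []
Bin-chain (suc j) =
  Allₚ.++⁺ (Allₚ.map⁺ (All.map (λ {R} 0∈R → Bin-Φ R (∈⇒nonempty 0∈R)) (0∈-chain j)))
           ((z≤n ∷ s≤s z≤n ∷ []) ∷ (s≤s z≤n ∷ z≤n ∷ []) ∷ [])

RotationOfSome : List Str → Str → Set
RotationOfSome us R = ∃ λ u → u ∈ us × Rot u R

chain-rotations : ∀ j → All (RotationOfSome (leading j)) (chain j)
chain-rotations zero = []
chain-rotations (suc j) =
  Allₚ.++⁺ (Allₚ.map⁺ (All.zipWith Φ-rotation (0∈-chain j , chain-rotations j)))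
           (rotation-of-01 (Rot-refl _) ∷ rotation-of-01 ([ 0 ] , [ 1 ] , refl , refl) ∷ [])
  where
  rotation-of-01 : ∀ {R} → Rot (0 ∷ 1 ∷ []) R → RotationOfSome (leading (suc j)) R
  rotation-of-01 r = _ , here refl , r
  Φ-rotation : ∀ {R} → 0 ∈ R × RotationOfSome (leading j) R → RotationOfSome (leading (suc j)) (Φ R)
  Φ-rotation {R} (0∈R , u , u∈ , rR) = ψ u , there (∈-map⁺ ψ u∈) , Rot-trans (ψ-Rot rR) (Rot-ψ-Φ R (∈⇒nonempty 0∈R))

chain-increasing : ∀ j → Linked _<ω_ (chain j)
chain-increasing zero = []
chain-increasing (suc j) =
  Linked-++-∷ (Linkedₚ.map⁺ (Φ-increasing (Bin-chain j) (0∈-chain j) (chain-increasing j)))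
              (Allₚ.map⁺ (All.zipWith (λ (bR , 0∈R) → Φ<ω01 bR 0∈R) (Bin-chain j , 0∈-chain j)))
              (Diverge⇒<ω (diverge [] [ 1 ] [ 0 ] z<s) ∷ [-])
  where
  Φ-increasing : ∀ {Rs} → All Bin Rs → All (0 ∈_) Rs → Linked _<ω_ Rs → Linked (λ R R′ → Φ R <ω Φ R′) Rs
  Φ-increasing [] [] [] = []
  Φ-increasing (_ ∷ []) (_ ∷ []) [-] = [-]
  Φ-increasing {R ∷ R′ ∷ _} (_ ∷ bs) (0∈R ∷ 0∈s) (R<R′ ∷ increasing) =
    Φ-mono-<ω {R} {R′} (All.head bs) (∈⇒nonempty 0∈R) (∈⇒nonempty (All.head 0∈s)) R<R′
    ∷ Φ-increasing bs 0∈s increasing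

[0]<ω-chain : ∀ j → All ([ 0 ] <ω_) (chain j)
[0]<ω-chain zero = []
[0]<ω-chain (suc j) =
  Allₚ.++⁺ (Allₚ.map⁺ (All.universal (λ R → [0]<ω01∷ (ψ′ R)) (chain j)))
           ([0]<ω01∷ [] ∷ Diverge⇒<ω (diverge [] [] [ 0 ] z<s) ∷ [])
  where
  [0]<ω01∷ : ∀ z → [ 0 ] <ω (0 ∷ 1 ∷ z)
  [0]<ω01∷ z = 1 , agree , subst (0 <_) (sym (omega-unfold (0 ∷ 1 ∷ z) z<s 1)) z<s
    where
    agree : ∀ i → i < 1 → omega [ 0 ] i ≡ omega (0 ∷ 1 ∷ z) i
    agree zero _ = sym (omega-unfold (0 ∷ 1 ∷ z) z<s 0)
    agree (suc _) (s<s ())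

lastChars-chain : ∀ j → map lastChar (chain j) ≡ (1 ∷ 0 ∷ []) ^^ j
lastChars-chain zero = refl
lastChars-chain (suc j) = begin
  map lastChar (map Φ (chain j) ++ (0 ∷ 1 ∷ []) ∷ (1 ∷ 0 ∷ []) ∷ []) ≡⟨ map-++ lastChar (map Φ (chain j)) _ ⟩
  map lastChar (map Φ (chain j)) ++ 1 ∷ 0 ∷ []                      ≡⟨ cong (_++ 1 ∷ 0 ∷ []) lastChars-Φ ⟩
  map lastChar (chain j) ++ 1 ∷ 0 ∷ []                              ≡⟨ cong (_++ 1 ∷ 0 ∷ []) (lastChars-chain j) ⟩
  (1 ∷ 0 ∷ []) ^^ j ++ 1 ∷ 0 ∷ []                                   ≡⟨ ^^-snoc (1 ∷ 0 ∷ []) j ⟩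
  (1 ∷ 0 ∷ []) ^^ suc j                                             ∎
  where
  open ≡-Reasoning
  lastChars-Φ : map lastChar (map Φ (chain j)) ≡ map lastChar (chain j)
  lastChars-Φ = trans (sym (map-∘ (chain j)))
    (map-cong-local (All.zipWith (λ {R} (bR , 0∈R) → lastChar-Φ R bR (∈⇒nonempty 0∈R)) (Bin-chain j , 0∈-chain j)))

runs-0∷alternating : ∀ j → runs (0 ∷ (1 ∷ 0 ∷ []) ^^ j) ≡ suc (j + j)
runs-0∷alternating zero = refl
runs-0∷alternating (suc j) = cong (λ n → suc (suc n)) (trans (runs-0∷alternating j) (sym (+-suc j j)))

module ≤ω-Sort = InsertionSort _≤ω_ ≤ω-total

BBWT-W-runs-≥ : ∀ k → Σ Str λ s → IsBBWT (W k) s × suc (k + k) ≤ runs s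
BBWT-W-runs-≥ k =
  map lastChar L , (factors k , LyndonFactorization-W k , L , ≤ω-Sort.sort-↭ M , ≤ω-Sort.sort-sorted M , refl) ,
  subst (_≤ runs (map lastChar L)) runs-witnesses (runs-mono-⊆ (⊆-map⁺ lastChar witnesses⊆L))
  where
  M = concatMap rotations (factors k)
  L = ≤ω-Sort.sort M
  witnesses = [ 0 ] ∷ chain k
  ∈L : ∀ {u R} → 0 < length R → u ∈ factors k → Rot u R → R ∈ L
  ∈L R≢[] u∈ rR = ∈-resp-↭ (↭-sym (≤ω-Sort.sort-↭ M))
                    (∈-concat⁺′ (Rot⇒∈rotations (subst (0 <_) (length-Rot rR) R≢[]) rR) (∈-map⁺ rotations u∈))
  witnesses∈L : All (_∈ L) witnesses
  witnesses∈L = ∈L z<s (∈-++⁺ʳ (leading k) (here refl)) (Rot-refl [ 0 ])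
              ∷ All.zipWith (λ (0∈R , u , u∈ , rR) → ∈L (∈⇒nonempty 0∈R) (∈-++⁺ˡ u∈) rR) (0∈-chain k , chain-rotations k)
  witnesses⊆L : witnesses ⊆ L
  witnesses⊆L = increasing-⊆-nondecreasing <ˢ-irrefl ≤ˢ-<ˢ-trans
                  (Linkedₚ.Linked⇒AllPairs <ˢ-trans (Linked-∷⁺ ([0]<ω-chain k) (chain-increasing k)))
                  (Linkedₚ.Linked⇒AllPairs ≤ˢ-trans (≤ω-Sort.sort-sorted M)) witnesses∈L
  runs-witnesses : runs (map lastChar witnesses) ≡ suc (k + k)
  runs-witnesses = trans (cong (λ t → runs (0 ∷ t)) (lastChars-chain k)) (runs-0∷alternating k)

length-W≤2^ : ∀ k {r} → suc (k + k) ≤ r → length (W k) ≤ 2 ^ r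
length-W≤2^ k {r} 2k<r = begin
  length (W k) ≤⟨ length-W≤3^ k ⟩
  3 ^ k        ≤⟨ ^-monoˡ-≤ k (s≤s (s≤s (s≤s z≤n))) ⟩
  (2 ^ 2) ^ k  ≡⟨ ^-*-assoc 2 2 k ⟩
  2 ^ (2 * k)  ≤⟨ ^-monoʳ-≤ 2 2k≤r ⟩
  2 ^ r        ∎
  where
  open ≤-Reasoning
  2k≤r : 2 * k ≤ r
  2k≤r = ≤-trans (≤-reflexive (cong (k +_) (+-identityʳ k))) (≤-trans (n≤1+n (k + k)) 2k<r)

BBWT-W-length≤2^runs : ∀ k → Σ Str λ s → IsBBWT (W k) s × length (W k) ≤ 2 ^ runs s
BBWT-W-length≤2^runs k = map₂ (map₂ (length-W≤2^ k)) (BBWT-W-runs-≥ k)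

theorem2 : Σ ℕ λ p → Σ ℕ λ q → (0 < p) × (0 < q) ×
    Σ (ℕ → Str) λ w →
      (∀ N → ∃ λ K → ∀ k → K ≤ k → N ≤ length (w k)) ×
      (∀ k → 2 ≤ length (w k) →
        (Σ Str λ s → IsBWT (w k) s × (runs s ≡ 2)) ×
        (Σ Str λ s → IsBBWT (w k) s × (length (w k) ^ p ≤ 2 ^ (q * runs s))))
theorem2 = 1 , 1 , z<s , z<s , W , unbounded , runs-bounds
  where
  unbounded : ∀ N → ∃ λ K → ∀ k → K ≤ k → N ≤ length (W k)
  unbounded N = N , λ k N≤k → ≤-trans N≤k (<⇒≤ (j<length-W k))
  runs-bounds : ∀ k → 2 ≤ length (W k) →
    (Σ Str λ s → IsBWT (W k) s × (runs s ≡ 2)) ×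
    (Σ Str λ s → IsBBWT (W k) s × (length (W k) ^ 1 ≤ 2 ^ (1 * runs s)))
  runs-bounds zero (s≤s ())
  runs-bounds (suc j) _ = BWT-W-runs≡2 j , map₂ (λ {s} → map₂ (with-p=q=1 {r = runs s})) (BBWT-W-length≤2^runs (suc j))
    where
    with-p=q=1 : ∀ {n r} → n ≤ 2 ^ r → n ^ 1 ≤ 2 ^ (1 * r)
    with-p=q=1 {n} {r} = subst₂ _≤_ (sym (^-identityʳ n)) (cong (2 ^_) (sym (*-identityˡ r)))
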